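{- Let $\sigma$ be a 2-structure and let $X\subsetneq V(\sigma)$ be such that $\sigma[X]$ is prime. If $\sigma$ admits a nontrivial module $M$ such that $M\cap X\neq\emptyset$, then $\Gamma_{(\sigma,\overline{X})}$ has isolated vertices.
   Context: A 2-structure $\sigma$ consists of a vertex set $V(\sigma)$ and an equivalence relation $\equiv_\sigma$ on the set of ordered pairs $(u,v)$ of distinct elements of $V(\sigma)$. For $W\subseteq V(\sigma)$, $\sigma[W]$ is the 2-structure on $W$ with the restricted equivalence relation. $\overline{X}=V(\sigma)\setminus X$. A subset $M\subseteq V(\sigma)$ is a module of $\sigma$ if for all $x,y\in M$ and $v\in V(\sigma)\setminus M$, $(x,v)\equiv_\sigma(y,v)$ and $(v,x)\equiv_\sigma(v,y)$; $\emptyset$, $V(\sigma)$ and singletons are trivial modules, the others are nontrivial. $\sigma$ is prime if $|V(\sigma)|\geq 3$ and all its modules are trivial. For $X\subsetneq V(\sigma)$ with $\sigma[X]$ prime, the outside graph $\Gamma_{(\sigma,\overline{X})}$ is the graph with vertex set $\overline{X}$ whose edges are the 2-element subsets $Y\subseteq\overline{X}$ such that $\sigma[X\cup Y]$ is prime. -}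

module Defs where

open import Data.Nat using (ℕ; _≤_)
open import Data.Fin using (Fin)
open import Data.Fin.Subset using (Subset; _∈_; _∉_; _⊆_; ⊥; ⊤; ⁅_⁆; _∪_; ∣_∣)
open import Data.Product using (_×_; ∃; Σ)
open import Data.Sum using (_⊎_)
open import Relation.Binary.Structures using (IsEquivalence)
open import Relation.Binary.PropositionalEquality using (_≡_; _≢_)
open import Relation.Nullary using (¬_)

-- The equivalence relation ≡σ is given on all ordered pairs of Fin n;
-- only its restriction to pairs of DISTINCT vertices is ever used below,
-- so this is exactly an equivalence relation on ordered pairs of distinct
-- vertices (any such one extends, e.g. with singleton classes on the diagonal).
record TwoStructure (n : ℕ) : Set₁ where
  field
    _≡σ_      : (Fin n × Fin n) → (Fin n × Fin n) → Set
    isEquiv   : IsEquivalence _≡σ_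

open TwoStructure public

open import Data.Product using (_,_)

-- Sub-2-structures σ[W] are represented by their vertex set W ⊆ V(σ),
-- the equivalence being the restriction of ≡σ.

IsModuleOf : ∀ {n} → TwoStructure n → Subset n → Subset n → Set
IsModuleOf σ W M =
  M ⊆ W ×
  (∀ x y v → x ∈ M → y ∈ M → v ∈ W → v ∉ M →
     (_≡σ_ σ (x , v) (y , v)) × (_≡σ_ σ (v , x) (v , y)))

Trivial : ∀ {n} → Subset n → Subset n → Set
Trivial W M = (M ≡ ⊥) ⊎ (M ≡ W) ⊎ ∃ (λ x → M ≡ ⁅ x ⁆)

IsPrime : ∀ {n} → TwoStructure n → Subset n → Set
IsPrime σ W = (3 ≤ ∣ W ∣) × (∀ M → IsModuleOf σ W M → Trivial W M)

OutsideEdge : ∀ {n} → TwoStructure n → Subset n → Fin n → Fin n → Set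
OutsideEdge σ X v w =
  v ∉ X × w ∉ X × v ≢ w × IsPrime σ (X ∪ (⁅ v ⁆ ∪ ⁅ w ⁆))

IsolatedVertex : ∀ {n} → TwoStructure n → Subset n → Fin n → Set
IsolatedVertex σ X v = v ∉ X × (∀ w → ¬ OutsideEdge σ X v w)

-- The trace M ∩ W of a module of σ is a module of σ[W].  If X ⊆ M,
-- pick v ∉ M: for every w, M ∩ (X ∪ {v, w}) contains X (at least three vertices)
-- but not v, so σ[X ∪ {v, w}] is not prime.  Otherwise primality of σ[X] makes
-- M ∩ X a singleton {x}; pick v ∈ M distinct from x (M is not a singleton), so
-- v ∉ X, and M ∩ (X ∪ {v, w}) contains x and v but misses a vertex of X ∖ M.
module Submission where

open import Defs
open import Data.Nat using (ℕ)
open import Data.Fin.Subset using (Subset; _⊂_; ⊤; _∩_; Nonempty)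
open import Data.Product using (∃)
open import Relation.Nullary using (¬_)

open import Data.Empty using (⊥-elim)
open import Data.Fin.Properties using (¬∀⟶∃¬)
open import Data.Fin.Subset using (_∈_; _∉_; _⊆_; ⁅_⁆; _∪_; ∣_∣)
open import Data.Fin.Subset.Properties
open import Data.Nat using (_≤_; s≤s; z≤n)
open import Data.Nat.Properties using (≤-trans; <⇒≱)
open import Data.Product using (_,_; _×_)
open import Data.Sum using (inj₁; inj₂)
open import Function using (_∘_; const)
open import Relation.Binary.PropositionalEquality using (_≡_; _≢_; subst; sym; trans)
open import Relation.Nullary using (yes; no; contradiction)
open import Relation.Nullary.Decidable using (_→-dec_)

⊈⇒∃∈∉ : ∀ {n} {p q : Subset n} → ¬ p ⊆ q → ∃ λ x → x ∈ p × x ∉ q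
⊈⇒∃∈∉ {n} {p} {q} p⊈q
  with ¬∀⟶∃¬ n (λ x → x ∈ p → x ∈ q) (λ x → x ∈? p →-dec x ∈? q) (λ p⊆q → p⊈q (p⊆q _))
... | x , x∈p↛x∈q with x ∈? p
...   | yes x∈p = x , x∈p , x∈p↛x∈q ∘ const
...   | no  x∉p = contradiction (⊥-elim ∘ x∉p) x∈p↛x∈q

x∈p∪[⁅x⁆∪⁅y⁆] : ∀ {n} (p : Subset n) x y → x ∈ p ∪ (⁅ x ⁆ ∪ ⁅ y ⁆)
x∈p∪[⁅x⁆∪⁅y⁆] p x y = q⊆p∪q p _ (p⊆p∪q ⁅ y ⁆ (x∈⁅x⁆ x))

∈-⊆⁅⁆⇒≡⁅⁆ : ∀ {n} {p : Subset n} {x} → x ∈ p → p ⊆ ⁅ x ⁆ → p ≡ ⁅ x ⁆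
∈-⊆⁅⁆⇒≡⁅⁆ {x = x} x∈p p⊆⁅x⁆ =
  ⊆-antisym p⊆⁅x⁆ (λ y∈⁅x⁆ → subst (_∈ _) (sym (x∈⁅y⁆⇒x≡y x y∈⁅x⁆)) x∈p)

3≤∣p∣⇒⊈⁅⁆ : ∀ {n} {p : Subset n} {x} → 3 ≤ ∣ p ∣ → ¬ p ⊆ ⁅ x ⁆
3≤∣p∣⇒⊈⁅⁆ {x = x} 3≤∣p∣ p⊆⁅x⁆ =
  <⇒≱ (s≤s (s≤s z≤n)) (≤-trans 3≤∣p∣ (subst (_ ≤_) (∣⁅x⁆∣≡1 x) (p⊆q⇒∣p∣≤∣q∣ p⊆⁅x⁆)))

module _ {n : ℕ} (σ : TwoStructure n) where

  module-∩ : ∀ {V W M} → IsModuleOf σ V M → W ⊆ V → IsModuleOf σ W (M ∩ W)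
  module-∩ {W = W} {M} (_ , modM) W⊆V = p∩q⊆q M W , λ x y v x∈ y∈ v∈W v∉M∩W →
    modM x y v (p∩q⊆p M W x∈) (p∩q⊆p M W y∈) (W⊆V v∈W) (v∉M∩W ∘ x∈p∩q⁺ ∘ (_, v∈W))

  prime-module-∈∉⇒singleton : ∀ {W N a c} → IsPrime σ W → IsModuleOf σ W N →
    a ∈ N → c ∈ W → c ∉ N → ∃ λ x → N ≡ ⁅ x ⁆
  prime-module-∈∉⇒singleton (_ , prime) modN a∈N c∈W c∉N with prime _ modN
  ... | inj₁ N≡⊥          = contradiction (subst (_ ∈_) N≡⊥ a∈N) ∉⊥
  ... | inj₂ (inj₁ N≡W)   = contradiction (subst (_ ∈_) (sym N≡W) c∈W) c∉N
  ... | inj₂ (inj₂ N≡⁅x⁆) = N≡⁅x⁆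

  outsideEdge-module-singleton : ∀ {X v w M a c} → OutsideEdge σ X v w → IsModuleOf σ ⊤ M →
    a ∈ M → a ∈ X ∪ (⁅ v ⁆ ∪ ⁅ w ⁆) → c ∉ M → c ∈ X ∪ (⁅ v ⁆ ∪ ⁅ w ⁆) →
    ∃ λ y → M ∩ (X ∪ (⁅ v ⁆ ∪ ⁅ w ⁆)) ≡ ⁅ y ⁆
  outsideEdge-module-singleton (_ , _ , _ , primeY) modM a∈M a∈Y c∉M c∈Y =
    prime-module-∈∉⇒singleton primeY (module-∩ modM ⊆⊤) (x∈p∩q⁺ (a∈M , a∈Y)) c∈Y
      (c∉M ∘ p∩q⊆p _ _)

  isolated-if-⊆-module : ∀ {X M v x} → IsPrime σ X → IsModuleOf σ ⊤ M →
    x ∈ X → X ⊆ M → v ∉ M → IsolatedVertex σ X v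
  isolated-if-⊆-module {X} {v = v} (3≤∣X∣ , _) modM x∈X X⊆M v∉M = v∉M ∘ X⊆M , noEdge
    where
    noEdge : ∀ w → ¬ OutsideEdge σ X v w
    noEdge w edge =
      let X⊆Y    = p⊆p∪q (⁅ v ⁆ ∪ ⁅ w ⁆)
          y , M∩Y≡⁅y⁆ = outsideEdge-module-singleton edge modM (X⊆M x∈X) (X⊆Y x∈X) v∉M
                          (x∈p∪[⁅x⁆∪⁅y⁆] X v w)
      in 3≤∣p∣⇒⊈⁅⁆ 3≤∣X∣ (subst (X ⊆_) M∩Y≡⁅y⁆ (λ z∈X → x∈p∩q⁺ (X⊆M z∈X , X⊆Y z∈X)))

  isolated-if-module-∩≡⁅⁆ : ∀ {X M v x z} → IsModuleOf σ ⊤ M → M ∩ X ≡ ⁅ x ⁆ →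
    z ∈ X → z ∉ M → v ∈ M → v ≢ x → IsolatedVertex σ X v
  isolated-if-module-∩≡⁅⁆ {X} {M} {v} {x} modM M∩X≡⁅x⁆ z∈X z∉M v∈M v≢x = v∉X , noEdge
    where
    v∉X : v ∉ X
    v∉X v∈X = v≢x (x∈⁅y⁆⇒x≡y x (subst (v ∈_) M∩X≡⁅x⁆ (x∈p∩q⁺ (v∈M , v∈X))))
    x∈M∩X : x ∈ M ∩ X
    x∈M∩X = subst (x ∈_) (sym M∩X≡⁅x⁆) (x∈⁅x⁆ x)
    noEdge : ∀ w → ¬ OutsideEdge σ X v w
    noEdge w edge =
      let X⊆Y = p⊆p∪q (⁅ v ⁆ ∪ ⁅ w ⁆)
          v∈Y = x∈p∪[⁅x⁆∪⁅y⁆] X v w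
          y , M∩Y≡⁅y⁆ = outsideEdge-module-singleton edge modM v∈M v∈Y z∉M (X⊆Y z∈X)
          ∈⁅y⁆ : ∀ {u} → u ∈ M → u ∈ X ∪ (⁅ v ⁆ ∪ ⁅ w ⁆) → u ≡ y
          ∈⁅y⁆ u∈M u∈Y = x∈⁅y⁆⇒x≡y y (subst (_ ∈_) M∩Y≡⁅y⁆ (x∈p∩q⁺ (u∈M , u∈Y)))
      in v≢x (trans (∈⁅y⁆ v∈M v∈Y) (sym (∈⁅y⁆ (p∩q⊆p M X x∈M∩X) (X⊆Y (p∩q⊆q M X x∈M∩X)))))

corollary2p4 : (n : ℕ) (σ : TwoStructure n) (X : Subset n) →
    X ⊂ ⊤ → IsPrime σ X →
    (M : Subset n) → IsModuleOf σ ⊤ M → ¬ Trivial ⊤ M → Nonempty (M ∩ X) →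
    ∃ (λ v → IsolatedVertex σ X v)
corollary2p4 n σ X _ primeX M modM nontrivial (a , a∈M∩X) with X ⊆? M
... | yes X⊆M =
  let v , _ , v∉M = ⊈⇒∃∈∉ (λ ⊤⊆M → nontrivial (inj₂ (inj₁ (⊆-antisym ⊆⊤ ⊤⊆M))))
  in v , isolated-if-⊆-module σ primeX modM (p∩q⊆q M X a∈M∩X) X⊆M v∉M
... | no X⊈M =
  let z , z∈X , z∉M = ⊈⇒∃∈∉ X⊈M
      x , M∩X≡⁅x⁆ = prime-module-∈∉⇒singleton σ primeX (module-∩ σ modM ⊆⊤) a∈M∩X z∈X
                      (z∉M ∘ p∩q⊆p M X)
      x∈M = p∩q⊆p M X (subst (x ∈_) (sym M∩X≡⁅x⁆) (x∈⁅x⁆ x))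
      v , v∈M , v∉⁅x⁆ = ⊈⇒∃∈∉ (λ M⊆⁅x⁆ → nontrivial (inj₂ (inj₂ (x , ∈-⊆⁅⁆⇒≡⁅⁆ x∈M M⊆⁅x⁆))))
  in v , isolated-if-module-∩≡⁅⁆ σ modM M∩X≡⁅x⁆ z∈X z∉M v∈M (x∉⁅y⁆⇒x≢y v∉⁅x⁆)
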